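{- Let $\mathbf{G}$ be a finite abelian group, and write $N=|\mathbf{G}|$. Let $n,d\in\mathbb{N}$ with $n\ge 2\log N$. Then the number of sets $X\subset\mathbf{G}$ with $0<|X|\le n$ and $\dim X\le d$ is at most $e^{2nd}$.
   Context: A finite set $\Lambda$ in an abelian group is dissociated if $\sum_{\lambda\in\Lambda}\varepsilon_\lambda\lambda=0$ with $\varepsilon_\lambda\in\{ -1,0,1\}$ implies $\varepsilon_\lambda=0$ for all $\lambda$. The (additive) dimension $\dim(X)$ of a finite set $X$ is the size of a largest dissociated subset of $X$. Logarithms are natural. -}

module Defs where

open import Data.Nat using (ℕ; zero; suc; _+_; _*_; _^_; _≤_; _!)
open import Data.Product using (∃)
open import Data.Fin using (Fin)
open import Data.Fin.Subset using (Subset; _∈_; _∉_; _⊆_; ∣_∣)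
open import Algebra.Core using (Op₁; Op₂)
open import Relation.Binary.PropositionalEquality using (_≡_)

-- expSum m K = K! * Σ_{j=0}^{K} m^j / j!   (a natural number)
expSum : ℕ → ℕ → ℕ
expSum m zero    = 1
expSum m (suc K) = suc K * expSum m K + m ^ suc K

-- x ≤ e^m  (for natural x, m): some partial sum of the exponential series
-- Σ_{j≤K} m^j/j! is ≥ x.  This is equivalent to x ≤ e^m, since the partial
-- sums increase to e^m, strictly below it when m > 0, and equal 1 = e^0 when m = 0.
LeExp : ℕ → ℕ → Set
LeExp x m = ∃ λ K → x * (K !) ≤ expSum m K

data Sign : Set where
  neg zer pos : Sign

module _ {N : ℕ} (_∙_ : Op₂ (Fin N)) (e : Fin N) (inv : Op₁ (Fin N)) where

  act : Sign → Fin N → Fin N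
  act neg g = inv g
  act zer g = e
  act pos g = g

  gsum : ∀ {k} → (Fin k → Fin N) → Fin N
  gsum {zero}  f = e
  gsum {suc k} f = f Fin.zero ∙ gsum (λ i → f (Fin.suc i))

  Dissociated : Subset N → Set
  Dissociated Λ =
    (c : Fin N → Sign) → (∀ g → g ∉ Λ → c g ≡ zer) →
    gsum (λ g → act (c g) g) ≡ e → ∀ g → g ∈ Λ → c g ≡ zer

  DimLe : Subset N → ℕ → Set
  DimLe X d = ∀ Λ → Λ ⊆ X → Dissociated Λ → ∣ Λ ∣ ≤ d

-- Let Λ ⊆ X be a maximal dissociated subset. Then |Λ| ≤ d, and every x ∈ X is a signed
-- sum Σ_{λ∈Λ} ε_λ λ, since otherwise Λ ∪ {x} would still be dissociated. Listing Λ in d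
-- slots (padded with 0) and each of the at most n elements of X as a sign vector in
-- {-1,0,1}^d, X is determined by a point of G^d × ({-1,0,1}^d)^n, so there are at most
-- N^d 3^(dn) such sets X. Finally (N^d 3^(dn))² = (N²)^d 9^(dn) ≤ e^(dn) e^(3dn) by
-- N² ≤ e^n and 9 ≤ e³, and taking square roots gives e^(2nd).
--
-- Constructively, a maximal dissociated subset exists only up to double negation; this
-- suffices because the bound on the count is a decidable inequality. The exponential
-- bounds go through the partial sums T_K(m) = Σ_{j≤K} m^j/j! = expSum m K / K!, which
-- satisfy T_K(a) T_L(b) ≤ T_{K+L}(a + b) and T_K(a + b) ≤ T_K(a) T_K(b); hence LeExp
-- is multiplicative and admits square roots.

module Submission where

open import Defs
open import Data.Nat using (ℕ; _*_; _≤_; _<_)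
open import Data.Fin using (Fin)
open import Data.Fin.Subset using (Subset; ∣_∣)
open import Data.List using (List; length)
open import Data.List.Relation.Unary.All using (All)
open import Data.List.Relation.Unary.Unique.Propositional using (Unique)
open import Data.Product using (_×_)
open import Algebra.Core using (Op₁; Op₂)
open import Algebra.Structures using (IsAbelianGroup)
open import Relation.Binary.PropositionalEquality using (_≡_)

open import Data.Nat using (zero; suc; _+_; _∸_; _^_; _!; _≤?_; z≤n; s≤s; z<s; s<s; s≤s⁻¹; +-*-rawSemiring)
open import Data.Nat.Properties
  using (≤-refl; ≤-trans; ≤-reflexive; <⇒≱; ≰⇒>; >⇒≢; m≤m+n; m≤n+m; m≤n⇒m≤1+n; m∸n≤m; n∸n≡0; m+[n∸m]≡n;
         +-comm; +-assoc; +-suc; +-identityʳ; +-∸-assoc; +-mono-≤; +-monoʳ-≤;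
         *-comm; *-assoc; *-zeroʳ; *-distribˡ-+; *-mono-≤; *-monoˡ-≤; *-monoʳ-≤; *-mono-<;
         *-cancelʳ-≡; *-cancelʳ-≤; ^-*-assoc; _!≢0; _!*_!≢0;
         +-*-commutativeSemiring; +-0-monoid; module ≤-Reasoning)
open import Data.Nat.Combinatorics using (_C_; nCk≡n!/k![n-k]!; k![n∸k]!∣n!)
open import Data.Nat.DivMod using (m/n*n≡m)
open import Data.Nat.Tactic.RingSolver using (solve-∀)
open import Data.Fin using (toℕ; _≟_)
import Data.Fin as Fin
import Data.Vec as Vec
open import Data.Vec.Functional using (updateAt)
open import Data.Vec.Functional.Properties using (updateAt-updates; updateAt-minimal)
open import Data.Fin.Subset using (inside; outside; _∈_; _∉_; _⊆_; _∪_; ⁅_⁆) renaming (⊥ to ∅)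
open import Data.Fin.Subset.Properties
  using (_∈?_; x∈p∪q⁺; x∈p∪q⁻; x∈⁅x⁆; x∈⁅y⁆⇒x≡y; ⊆-antisym; ∉⊥; ∣p∣≤n; p⊆p∪q; p⊂q⇒∣p∣<∣q∣; drop-there)
open import Data.List using ([]; _∷_; map; foldr; _++_; allFin; cartesianProductWith)
open import Data.List.Properties using (length-map; length-++; length-removeAt′; length-tabulate; map-∘)
open import Data.List.Membership.Propositional using (_─_) renaming (_∈_ to _∈ₗ_)
open import Data.List.Membership.Propositional.Properties using (∈-map⁺; ∈-map⁻; ∈-allFin; ∈-cartesianProductWith⁺)
open import Data.List.Relation.Unary.Any using (here; there; index)
open import Data.List.Relation.Unary.All as All using ([]; _∷_; sequenceM)
open import Data.List.Relation.Unary.AllPairs using (_∷_)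
open import Data.Product using (∃; _,_)
open import Data.Sum using (_⊎_; inj₁; inj₂; [_,_]′)
open import Data.Unit using (tt)
open import Function using (_∘_; const; id; flip)
open import Algebra.Bundles using (AbelianGroup)
open import Effect.Monad using (RawMonad)
open import Level using (0ℓ)
open import Relation.Nullary using (¬_; yes; no; contradiction)
open import Relation.Nullary.Decidable using (decidable-stable; toWitness)
open import Relation.Nullary.Negation using (¬¬-Monad)
open import Relation.Binary.PropositionalEquality using (_≢_; refl; sym; trans; cong; cong₂; subst; ≢-sym; module ≡-Reasoning)
import Algebra.Properties.CommutativeSemiring.Binomial +-*-commutativeSemiring as Binomial
import Algebra.Properties.Monoid.Sum +-0-monoid as MonoidSum
import Algebra.Definitions.RawSemiring +-*-rawSemiring as RawSemiring

private
  variable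
    A B D : Set

-- Lists and finite subsets

∈-─⁺ : ∀ {x z} {ys : List A} (x∈ys : x ∈ₗ ys) → z ∈ₗ ys → z ≢ x → z ∈ₗ ys ─ x∈ys
∈-─⁺ (here refl) (here refl) z≢x = contradiction refl z≢x
∈-─⁺ (here refl) (there z∈ys) _   = z∈ys
∈-─⁺ (there x∈ys) (here refl) _   = here refl
∈-─⁺ (there x∈ys) (there z∈ys) z≢x = there (∈-─⁺ x∈ys z∈ys z≢x)

pigeonhole : ∀ {xs ys : List A} → Unique xs → All (_∈ₗ ys) xs → length xs ≤ length ys
pigeonhole {xs = []}     _               _              = z≤n
pigeonhole {xs = x ∷ xs} {ys} (x≢xs ∷ unique) (x∈ys ∷ xs⊆ys) =
  subst (suc (length xs) ≤_) (sym (length-removeAt′ ys (index x∈ys)))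
    (s≤s (pigeonhole unique (All.zipWith (λ (x≢z , z∈ys) → ∈-─⁺ x∈ys z∈ys (≢-sym x≢z)) (x≢xs , xs⊆ys))))

padTo : A → ℕ → List A → List A
padTo a zero    _        = []
padTo a (suc n) []       = a ∷ padTo a n []
padTo a (suc n) (x ∷ xs) = x ∷ padTo a n xs

length-padTo : ∀ (a : A) n xs → length (padTo a n xs) ≡ n
length-padTo a zero    _        = refl
length-padTo a (suc n) []       = cong suc (length-padTo a n [])
length-padTo a (suc n) (x ∷ xs) = cong suc (length-padTo a n xs)

All-padTo : ∀ {P : A → Set} {a} n {xs} → P a → All P xs → All P (padTo a n xs)
All-padTo zero    _  _          = []
All-padTo (suc n) pa []         = pa ∷ All-padTo n pa []
All-padTo (suc n) pa (px ∷ pxs) = px ∷ All-padTo n pa pxs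

∈-padTo⁺ : ∀ {a x : A} {n xs} → length xs ≤ n → x ∈ₗ xs → x ∈ₗ padTo a n xs
∈-padTo⁺ {n = suc n} {_ ∷ _}  _           (here refl)  = here refl
∈-padTo⁺ {n = suc n} {_ ∷ xs} (s≤s ∣xs∣≤n) (there x∈xs) = there (∈-padTo⁺ ∣xs∣≤n x∈xs)

map-padTo : ∀ (f : A → B) a n xs → map f (padTo a n xs) ≡ padTo (f a) n (map f xs)
map-padTo f a zero    _        = refl
map-padTo f a (suc n) []       = cong (f a ∷_) (map-padTo f a n [])
map-padTo f a (suc n) (x ∷ xs) = cong (f x ∷_) (map-padTo f a n xs)

vectors : List A → ℕ → List (List A)
vectors xs zero    = [] ∷ []
vectors xs (suc k) = cartesianProductWith _∷_ xs (vectors xs k)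

length-cartesianProductWith : ∀ (f : A → B → D) xs ys →
                              length (cartesianProductWith f xs ys) ≡ length xs * length ys
length-cartesianProductWith f []       ys = refl
length-cartesianProductWith f (x ∷ xs) ys = begin
  length (map (f x) ys ++ cartesianProductWith f xs ys)      ≡⟨ length-++ (map (f x) ys) ⟩
  length (map (f x) ys) + length (cartesianProductWith f xs ys)
    ≡⟨ cong₂ _+_ (length-map (f x) ys) (length-cartesianProductWith f xs ys) ⟩
  length ys + length xs * length ys                          ∎
  where open ≡-Reasoning

length-vectors : ∀ (xs : List A) k → length (vectors xs k) ≡ length xs ^ k
length-vectors xs zero    = refl
length-vectors xs (suc k) = trans (length-cartesianProductWith _∷_ xs (vectors xs k))
                                  (cong (length xs *_) (length-vectors xs k))

∈-vectors⁺ : ∀ {xs : List A} k {ys} → length ys ≡ k → All (_∈ₗ xs) ys → ys ∈ₗ vectors xs k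
∈-vectors⁺ zero    refl []            = here refl
∈-vectors⁺ (suc k) refl (y∈xs ∷ ys⊆xs) = ∈-cartesianProductWith⁺ _∷_ y∈xs (∈-vectors⁺ k refl ys⊆xs)

elements : ∀ {n} → Subset n → List (Fin n)
elements Vec.[]            = []
elements (inside Vec.∷ p)  = Fin.zero ∷ map Fin.suc (elements p)
elements (outside Vec.∷ p) = map Fin.suc (elements p)

∈-elements⁺ : ∀ {n} {p : Subset n} {x} → x ∈ p → x ∈ₗ elements p
∈-elements⁺ {p = inside Vec.∷ p}  Vec.here       = here refl
∈-elements⁺ {p = inside Vec.∷ p}  (Vec.there x∈p) = there (∈-map⁺ Fin.suc (∈-elements⁺ x∈p))
∈-elements⁺ {p = outside Vec.∷ p} (Vec.there x∈p) = ∈-map⁺ Fin.suc (∈-elements⁺ x∈p)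

∈-elements⁻ : ∀ {n} {p : Subset n} {x} → x ∈ₗ elements p → x ∈ p
∈-elements⁻ {p = inside Vec.∷ p} (here refl) = Vec.here
∈-elements⁻ {p = inside Vec.∷ p} (there x∈) with ∈-map⁻ Fin.suc x∈
... | _ , y∈ , refl = Vec.there (∈-elements⁻ y∈)
∈-elements⁻ {p = outside Vec.∷ p} x∈ with ∈-map⁻ Fin.suc x∈
... | _ , y∈ , refl = Vec.there (∈-elements⁻ y∈)

length-elements : ∀ {n} (p : Subset n) → length (elements p) ≡ ∣ p ∣
length-elements Vec.[]            = refl
length-elements (inside Vec.∷ p)  = cong suc (trans (length-map Fin.suc (elements p)) (length-elements p))
length-elements (outside Vec.∷ p) = trans (length-map Fin.suc (elements p)) (length-elements p)

fromList : ∀ {n} → List (Fin n) → Subset n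
fromList []       = ∅
fromList (x ∷ xs) = ⁅ x ⁆ ∪ fromList xs

∈-fromList⁺ : ∀ {n} {x : Fin n} {xs} → x ∈ₗ xs → x ∈ fromList xs
∈-fromList⁺ {x = x} (here refl) = x∈p∪q⁺ (inj₁ (x∈⁅x⁆ x))
∈-fromList⁺         (there x∈)  = x∈p∪q⁺ (inj₂ (∈-fromList⁺ x∈))

fromList-⊆ : ∀ {n} {p : Subset n} {xs} → All (_∈ p) xs → fromList xs ⊆ p
fromList-⊆ []                    y∈∅ = contradiction y∈∅ ∉⊥
fromList-⊆ {xs = x ∷ xs} (x∈p ∷ xs⊆p) y∈ with x∈p∪q⁻ ⁅ x ⁆ (fromList xs) y∈
... | inj₁ y∈⁅x⁆ = subst (_∈ _) (sym (x∈⁅y⁆⇒x≡y x y∈⁅x⁆)) x∈p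
... | inj₂ y∈xs  = fromList-⊆ xs⊆p y∈xs

fromList-padTo-elements : ∀ {n} {p : Subset n} {x m} → x ∈ p → ∣ p ∣ ≤ m →
                          fromList (padTo x m (elements p)) ≡ p
fromList-padTo-elements {p = p} {x} {m} x∈p ∣p∣≤m = ⊆-antisym
  (fromList-⊆ (All-padTo m x∈p (All.tabulate ∈-elements⁻)))
  (λ y∈p → ∈-fromList⁺ (∈-padTo⁺ (subst (_≤ m) (sym (length-elements p)) ∣p∣≤m) (∈-elements⁺ y∈p)))

All-image⇒map : ∀ {P : B → Set} {f : B → A} {xs} → All (λ x → ∃ λ y → P y × f y ≡ x) xs →
                ∃ λ ys → All P ys × map f ys ≡ xs
All-image⇒map []                      = [] , [] , refl
All-image⇒map ((y , py , refl) ∷ pxs) with All-image⇒map pxs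
... | ys , pys , refl = y ∷ ys , py ∷ pys , refl

-- Signed sums in a finite abelian group

module _ {N : ℕ} {_∙_ : Op₂ (Fin N)} {e : Fin N} {inv : Op₁ (Fin N)}
         (isAbelianGroup : IsAbelianGroup _≡_ _∙_ e inv) where

  private
    G : AbelianGroup _ _
    G = record { isAbelianGroup = isAbelianGroup }

  open IsAbelianGroup isAbelianGroup using (identityˡ; identityʳ)
  open import Algebra.Properties.AbelianGroup G using (⁻¹-∙-comm; inverseˡ-unique; inverseʳ-unique; ε⁻¹≈ε; ⁻¹-involutive)
  open import Algebra.Properties.CommutativeSemigroup (AbelianGroup.commutativeSemigroup G) using (x∙yz≈y∙xz)

  infix 25 _·_
  _·_ : Sign → Fin N → Fin N
  _·_ = act _∙_ e inv

  ∑ᴳ : ∀ {k} → (Fin k → Fin N) → Fin N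
  ∑ᴳ = gsum _∙_ e inv

  ∑ᴳ-cong : ∀ {k} {f g : Fin k → Fin N} → (∀ i → f i ≡ g i) → ∑ᴳ f ≡ ∑ᴳ g
  ∑ᴳ-cong {zero}  f≗g = refl
  ∑ᴳ-cong {suc k} f≗g = cong₂ _∙_ (f≗g Fin.zero) (∑ᴳ-cong (f≗g ∘ Fin.suc))

  ∑ᴳ-ε : ∀ {k} {f : Fin k → Fin N} → (∀ i → f i ≡ e) → ∑ᴳ f ≡ e
  ∑ᴳ-ε {zero}  f≗ε = refl
  ∑ᴳ-ε {suc k} f≗ε = trans (cong₂ _∙_ (f≗ε Fin.zero) (∑ᴳ-ε (f≗ε ∘ Fin.suc))) (identityˡ e)

  ∑ᴳ-⁻¹ : ∀ {k} (f : Fin k → Fin N) → ∑ᴳ (inv ∘ f) ≡ inv (∑ᴳ f)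
  ∑ᴳ-⁻¹ {zero}  f = sym ε⁻¹≈ε
  ∑ᴳ-⁻¹ {suc k} f = trans (cong (inv (f Fin.zero) ∙_) (∑ᴳ-⁻¹ (f ∘ Fin.suc))) (⁻¹-∙-comm _ _)

  ∑ᴳ-updateAt : ∀ {k} (f : Fin k → Fin N) i → ∑ᴳ f ≡ f i ∙ ∑ᴳ (updateAt f i (const e))
  ∑ᴳ-updateAt f Fin.zero    = cong (f Fin.zero ∙_) (sym (identityˡ _))
  ∑ᴳ-updateAt f (Fin.suc i) = trans (cong (f Fin.zero ∙_) (∑ᴳ-updateAt (f ∘ Fin.suc) i)) (x∙yz≈y∙xz _ _ _)

  ∑ᴳ-elements-tail : ∀ {k s} (Λ : Subset k) (f : Fin (suc k) → Fin N) → (∀ i → i ∉ s Vec.∷ Λ → f i ≡ e) →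
                     ∑ᴳ (f ∘ Fin.suc) ≡ foldr _∙_ e (map f (map Fin.suc (elements Λ)))

  ∑ᴳ-elements : ∀ {k} (Λ : Subset k) (f : Fin k → Fin N) → (∀ i → i ∉ Λ → f i ≡ e) →
                ∑ᴳ f ≡ foldr _∙_ e (map f (elements Λ))
  ∑ᴳ-elements Vec.[]            f _   = refl
  ∑ᴳ-elements (inside Vec.∷ Λ)  f f|Λ = cong (f Fin.zero ∙_) (∑ᴳ-elements-tail Λ f f|Λ)
  ∑ᴳ-elements (outside Vec.∷ Λ) f f|Λ =
    trans (cong₂ _∙_ (f|Λ Fin.zero λ ()) (∑ᴳ-elements-tail Λ f f|Λ)) (identityˡ _)

  ∑ᴳ-elements-tail Λ f f|Λ = trans
    (∑ᴳ-elements Λ (f ∘ Fin.suc) (λ i i∉Λ → f|Λ (Fin.suc i) (i∉Λ ∘ drop-there)))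
    (cong (foldr _∙_ e) (map-∘ (elements Λ)))

  signedSum : (Fin N → Sign) → Fin N
  signedSum c = ∑ᴳ (λ g → c g · g)

  _SupportedOn_ : (Fin N → Sign) → Subset N → Set
  c SupportedOn Λ = ∀ g → g ∉ Λ → c g ≡ zer

  SignedSumOf : Subset N → Fin N → Set
  SignedSumOf Λ x = ∃ λ c → c SupportedOn Λ × signedSum c ≡ x

  signedSum-zero : ∀ {c} → (∀ g → c g ≡ zer) → signedSum c ≡ e
  signedSum-zero c≗zer = ∑ᴳ-ε (λ g → cong (_· g) (c≗zer g))

  signedSum-updateAt : ∀ c x → signedSum c ≡ c x · x ∙ signedSum (updateAt c x (const zer))
  signedSum-updateAt c x = trans (∑ᴳ-updateAt (λ g → c g · g) x) (cong (c x · x ∙_) (∑ᴳ-cong pointwise))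
    where
    pointwise : ∀ g → updateAt (λ g → c g · g) x (const e) g ≡ updateAt c x (const zer) g · g
    pointwise g with g ≟ x
    ... | yes refl = trans (updateAt-updates g _) (cong (_· g) (sym (updateAt-updates g c)))
    ... | no  g≢x  = trans (updateAt-minimal g x _ g≢x) (cong (_· g) (sym (updateAt-minimal g x c g≢x)))

  opposite : Sign → Sign
  opposite neg = pos
  opposite zer = zer
  opposite pos = neg

  ·-opposite : ∀ s g → opposite s · g ≡ inv (s · g)
  ·-opposite neg g = sym (⁻¹-involutive g)
  ·-opposite zer g = sym ε⁻¹≈ε
  ·-opposite pos g = refl

  signedSum-opposite : ∀ c → signedSum (opposite ∘ c) ≡ inv (signedSum c)
  signedSum-opposite c = trans (∑ᴳ-cong (λ g → ·-opposite (c g) g)) (∑ᴳ-⁻¹ (λ g → c g · g))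

  signedSumOf-∈ : ∀ {Λ x} → x ∈ Λ → SignedSumOf Λ x
  signedSumOf-∈ {Λ} {x} x∈Λ = δ , supported , signedSum-δ
    where
    δ : Fin N → Sign
    δ = updateAt (const zer) x (const pos)
    supported : δ SupportedOn Λ
    supported g g∉Λ = updateAt-minimal g x _ (λ { refl → g∉Λ x∈Λ })
    vanishes : ∀ g → updateAt δ x (const zer) g ≡ zer
    vanishes g with g ≟ x
    ... | yes refl = updateAt-updates g δ
    ... | no  g≢x  = trans (updateAt-minimal g x δ g≢x) (updateAt-minimal g x _ g≢x)
    signedSum-δ : signedSum δ ≡ x
    signedSum-δ = trans (signedSum-updateAt δ x)
      (trans (cong₂ _∙_ (cong (_· x) (updateAt-updates x _)) (signedSum-zero vanishes)) (identityʳ x))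

  signedSumOf-or-zer : ∀ {Λ c s x} → c SupportedOn Λ → s · x ∙ signedSum c ≡ e → s ≡ zer ⊎ SignedSumOf Λ x
  signedSumOf-or-zer {s = zer} _ _ = inj₁ refl
  signedSumOf-or-zer {c = c} {pos} {x} supp x∙v≡ε =
    inj₂ (opposite ∘ c , (λ g g∉Λ → cong opposite (supp g g∉Λ)) ,
          trans (signedSum-opposite c) (sym (inverseˡ-unique x _ x∙v≡ε)))
  signedSumOf-or-zer {c = c} {neg} {x} supp x⁻¹∙v≡ε =
    inj₂ (c , supp , trans (inverseʳ-unique _ _ x⁻¹∙v≡ε) (⁻¹-involutive x))

  dissociated-∅ : Dissociated _∙_ e inv ∅
  dissociated-∅ _ _ _ g g∈∅ = contradiction g∈∅ ∉⊥

  dissociated-∪-⁅⁆ : ∀ {Λ x} → Dissociated _∙_ e inv Λ → ¬ SignedSumOf Λ x →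
                     Dissociated _∙_ e inv (Λ ∪ ⁅ x ⁆)
  dissociated-∪-⁅⁆ {Λ} {x} dissociated x∉±Λ c supported signedSum≡ε = vanishes
    where
    off-Λ∪x : ∀ {g} → g ∉ Λ → g ≢ x → c g ≡ zer
    off-Λ∪x g∉Λ g≢x = supported _ (λ g∈ → [ g∉Λ , g≢x ∘ x∈⁅y⁆⇒x≡y x ]′ (x∈p∪q⁻ Λ ⁅ x ⁆ g∈))
    c₀-supported : updateAt c x (const zer) SupportedOn Λ
    c₀-supported g g∉Λ with g ≟ x
    ... | yes refl = updateAt-updates g c
    ... | no  g≢x  = trans (updateAt-minimal g x c g≢x) (off-Λ∪x g∉Λ g≢x)
    cx≡zer : c x ≡ zer
    cx≡zer = [ id , flip contradiction x∉±Λ ]′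
      (signedSumOf-or-zer c₀-supported (trans (sym (signedSum-updateAt c x)) signedSum≡ε))
    c-supported : c SupportedOn Λ
    c-supported g g∉Λ with g ≟ x
    ... | yes refl = cx≡zer
    ... | no  g≢x  = off-Λ∪x g∉Λ g≢x
    vanishes : ∀ g → g ∈ Λ ∪ ⁅ x ⁆ → c g ≡ zer
    vanishes g g∈ with x∈p∪q⁻ Λ ⁅ x ⁆ g∈
    ... | inj₁ g∈Λ  = dissociated c c-supported signedSum≡ε g g∈Λ
    ... | inj₂ g∈⁅x⁆ rewrite x∈⁅y⁆⇒x≡y x g∈⁅x⁆ = cx≡zer

  record MaximalDissociated (X Λ : Subset N) : Set where
    field
      ⊆X          : Λ ⊆ X
      dissociated : Dissociated _∙_ e inv Λ
      maximal     : ∀ {x} → x ∈ X → x ∉ Λ → ¬ Dissociated _∙_ e inv (Λ ∪ ⁅ x ⁆)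

  ¬¬-maximalDissociated : ∀ X → ¬ ¬ ∃ (MaximalDissociated X)
  ¬¬-maximalDissociated X =
    extend (suc N) ∅ (λ x∈∅ → contradiction x∈∅ ∉⊥) dissociated-∅ (s≤s (m≤m+n N _))
    where
    -- every extension strictly enlarges Λ ⊆ Fin N, so the fuel k never runs out
    extend : ∀ k Λ → Λ ⊆ X → Dissociated _∙_ e inv Λ → N < k + ∣ Λ ∣ → ¬ ¬ ∃ (MaximalDissociated X)
    extend zero    Λ _   _           N<∣Λ∣ _ = <⇒≱ N<∣Λ∣ (∣p∣≤n Λ)
    extend (suc k) Λ Λ⊆X dissociated bound ¬max =
      ¬max (Λ , record { ⊆X = Λ⊆X ; dissociated = dissociated ; maximal = grow })
      where
      grow : ∀ {x} → x ∈ X → x ∉ Λ → ¬ Dissociated _∙_ e inv (Λ ∪ ⁅ x ⁆)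
      grow {x} x∈X x∉Λ dissociated′ = extend k (Λ ∪ ⁅ x ⁆) Λ∪x⊆X dissociated′ bound′ ¬max
        where
        Λ∪x⊆X : Λ ∪ ⁅ x ⁆ ⊆ X
        Λ∪x⊆X y∈ = [ Λ⊆X , (λ y∈⁅x⁆ → subst (_∈ X) (sym (x∈⁅y⁆⇒x≡y x y∈⁅x⁆)) x∈X) ]′ (x∈p∪q⁻ Λ ⁅ x ⁆ y∈)
        ∣Λ∣<∣Λ∪x∣ : ∣ Λ ∣ < ∣ Λ ∪ ⁅ x ⁆ ∣
        ∣Λ∣<∣Λ∪x∣ = p⊂q⇒∣p∣<∣q∣ (p⊆p∪q ⁅ x ⁆ , x , x∈p∪q⁺ (inj₂ (x∈⁅x⁆ x)) , x∉Λ)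
        bound′ : N < k + ∣ Λ ∪ ⁅ x ⁆ ∣
        bound′ = ≤-trans bound (≤-trans (≤-reflexive (sym (+-suc k ∣ Λ ∣))) (+-monoʳ-≤ k ∣Λ∣<∣Λ∪x∣))

  maximal⇒signedSumOf : ∀ {X Λ x} → MaximalDissociated X Λ → x ∈ X → ¬ ¬ SignedSumOf Λ x
  maximal⇒signedSumOf {Λ = Λ} {x} max x∈X x∉±Λ with x ∈? Λ
  ... | yes x∈Λ = x∉±Λ (signedSumOf-∈ x∈Λ)
  ... | no  x∉Λ = MaximalDissociated.maximal max x∈X x∉Λ
                    (dissociated-∪-⁅⁆ (MaximalDissociated.dissociated max) x∉±Λ)

  combination : List (Fin N) → List Sign → Fin N
  combination []       _        = e
  combination (_ ∷ _)  []       = e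
  combination (g ∷ gs) (s ∷ σ)  = s · g ∙ combination gs σ

  foldr-as-combination : ∀ c d gs → length gs ≤ d →
                         foldr _∙_ e (map (λ g → c g · g) gs) ≡ combination (padTo e d gs) (padTo zer d (map c gs))
  foldr-as-combination c zero    []       _            = refl
  foldr-as-combination c (suc d) []       _            =
    trans (foldr-as-combination c d [] z≤n) (sym (identityˡ _))
  foldr-as-combination c (suc d) (g ∷ gs) (s≤s ∣gs∣≤d) = cong (c g · g ∙_) (foldr-as-combination c d gs ∣gs∣≤d)

  signedSum-as-combination : ∀ {c Λ d} → c SupportedOn Λ → ∣ Λ ∣ ≤ d →
                             signedSum c ≡ combination (padTo e d (elements Λ)) (padTo zer d (map c (elements Λ)))
  signedSum-as-combination {c} {Λ} {d} supported ∣Λ∣≤d = trans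
    (∑ᴳ-elements Λ (λ g → c g · g) (λ g g∉Λ → cong (_· g) (supported g g∉Λ)))
    (foldr-as-combination c d (elements Λ) (subst (_≤ d) (sym (length-elements Λ)) ∣Λ∣≤d))

  signs : List Sign
  signs = neg ∷ zer ∷ pos ∷ []

  ∈-signs : ∀ s → s ∈ₗ signs
  ∈-signs neg = here refl
  ∈-signs zer = there (here refl)
  ∈-signs pos = there (there (here refl))

  combinationSets : ℕ → ℕ → List (Subset N)
  combinationSets n d = cartesianProductWith (λ gs σs → fromList (map (combination gs) σs))
                                        (vectors (allFin N) d) (vectors (vectors signs d) n)

  length-combinationSets : ∀ n d → length (combinationSets n d) ≡ N ^ d * (3 ^ d) ^ n
  length-combinationSets n d = trans (length-cartesianProductWith _ (vectors (allFin N) d) _)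
    (cong₂ _*_ (trans (length-vectors (allFin N) d) (cong (_^ d) (length-tabulate id)))
               (trans (length-vectors (vectors signs d) n) (cong (_^ n) (length-vectors signs d))))

  ∈-combinationSets : ∀ {n d X gs} → gs ∈ₗ vectors (allFin N) d → 0 < ∣ X ∣ → ∣ X ∣ ≤ n →
                      All (λ x → ∃ λ σ → σ ∈ₗ vectors signs d × combination gs σ ≡ x) (elements X) →
                      X ∈ₗ combinationSets n d
  ∈-combinationSets {n} {d} {X} {gs} gs∈ 0<∣X∣ ∣X∣≤n signatures with All-image⇒map signatures
  ... | [] , _ , []≡elements =
    contradiction (trans (sym (length-elements X)) (cong length (sym []≡elements))) (>⇒≢ 0<∣X∣)
  ... | σ₀ ∷ σs , σ₀∈ ∷ σs∈ , σ₀σs↦elements =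
    subst (_∈ₗ combinationSets n d) decode≡X (∈-cartesianProductWith⁺ _ gs∈ padded∈)
    where
    open ≡-Reasoning
    padded∈ : padTo σ₀ n (σ₀ ∷ σs) ∈ₗ vectors (vectors signs d) n
    padded∈ = ∈-vectors⁺ n (length-padTo σ₀ n _) (All-padTo n σ₀∈ (σ₀∈ ∷ σs∈))
    combination-σ₀∈X : combination gs σ₀ ∈ X
    combination-σ₀∈X = ∈-elements⁻ (subst (combination gs σ₀ ∈ₗ_) σ₀σs↦elements (here refl))
    decode≡X : fromList (map (combination gs) (padTo σ₀ n (σ₀ ∷ σs))) ≡ X
    decode≡X = begin
      fromList (map (combination gs) (padTo σ₀ n (σ₀ ∷ σs)))
        ≡⟨ cong fromList (map-padTo (combination gs) σ₀ n _) ⟩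
      fromList (padTo (combination gs σ₀) n (map (combination gs) (σ₀ ∷ σs)))
        ≡⟨ cong (fromList ∘ padTo _ n) σ₀σs↦elements ⟩
      fromList (padTo (combination gs σ₀) n (elements X))
        ≡⟨ fromList-padTo-elements combination-σ₀∈X ∣X∣≤n ⟩
      X
        ∎

  ¬¬-∈-combinationSets : ∀ {n d X} → 0 < ∣ X ∣ → ∣ X ∣ ≤ n → DimLe _∙_ e inv X d →
                         ¬ ¬ X ∈ₗ combinationSets n d
  ¬¬-∈-combinationSets {n} {d} {X} 0<∣X∣ ∣X∣≤n dim = do
    Λ , max ← ¬¬-maximalDissociated X
    let open MaximalDissociated max
        gs = padTo e d (elements Λ)
        gs∈ : gs ∈ₗ vectors (allFin N) d
        gs∈ = ∈-vectors⁺ d (length-padTo e d _) (All.tabulate (λ {g} _ → ∈-allFin g))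
        signature : ∀ {x} → x ∈ X → ¬ ¬ ∃ λ σ → σ ∈ₗ vectors signs d × combination gs σ ≡ x
        signature x∈X = do
          c , supported , signedSum≡x ← maximal⇒signedSumOf max x∈X
          let σ = padTo zer d (map c (elements Λ))
          pure (σ , ∈-vectors⁺ d (length-padTo zer d _) (All.tabulate (λ {s} _ → ∈-signs s)) ,
                trans (sym (signedSum-as-combination supported (dim Λ ⊆X dissociated))) signedSum≡x)
    signatures ← sequenceM 0ℓ ¬¬-Monad (All.tabulate (signature ∘ ∈-elements⁻))
    pure (∈-combinationSets {n} {d} gs∈ 0<∣X∣ ∣X∣≤n signatures)
    where open RawMonad ¬¬-Monad

  bounded-dimension-count : ∀ n d {Xs} → Unique Xs →
                            All (λ X → 0 < ∣ X ∣ × ∣ X ∣ ≤ n × DimLe _∙_ e inv X d) Xs →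
                            length Xs ≤ N ^ d * (3 ^ d) ^ n
  bounded-dimension-count n d unique Xs-props = decidable-stable (_ ≤? _) do
    Xs⊆combinationSets ← sequenceM 0ℓ ¬¬-Monad
      (All.map (λ (0<∣X∣ , ∣X∣≤n , dim) → ¬¬-∈-combinationSets 0<∣X∣ ∣X∣≤n dim) Xs-props)
    pure (subst (_ ≤_) (length-combinationSets n d) (pigeonhole unique Xs⊆combinationSets))
    where open RawMonad ¬¬-Monad

-- Partial sums of the exponential series

m*m≤n*n⇒m≤n : ∀ {m n} → m * m ≤ n * n → m ≤ n
m*m≤n*n⇒m≤n {m} {n} m²≤n² with m ≤? n
... | yes m≤n = m≤n
... | no  m≰n = contradiction m²≤n² (<⇒≱ (*-mono-< (≰⇒> m≰n) (≰⇒> m≰n)))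

^-distribʳ-* : ∀ a b o → (a * b) ^ o ≡ a ^ o * b ^ o
^-distribʳ-* a b zero    = refl
^-distribʳ-* a b (suc o) = trans (cong (a * b *_) (^-distribʳ-* a b o)) (interchange a b (a ^ o) (b ^ o))
  where
  interchange : ∀ a b x y → a * b * (x * y) ≡ a * x * (b * y)
  interchange = solve-∀

∑< : ℕ → (ℕ → ℕ) → ℕ
∑< zero    f = 0
∑< (suc n) f = f 0 + ∑< n (f ∘ suc)

infix 5 ∑<
syntax ∑< n (λ l → t) = ∑[ l < n ] t

∑-cong : ∀ n {f g : ℕ → ℕ} → (∀ l → l < n → f l ≡ g l) → ∑< n f ≡ ∑< n g
∑-cong zero    f≡g = refl
∑-cong (suc n) f≡g = cong₂ _+_ (f≡g 0 z<s) (∑-cong n (λ l l<n → f≡g (suc l) (s<s l<n)))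

∑-mono-≤ : ∀ n {f g : ℕ → ℕ} → (∀ l → l < n → f l ≤ g l) → ∑< n f ≤ ∑< n g
∑-mono-≤ zero    f≤g = z≤n
∑-mono-≤ (suc n) f≤g = +-mono-≤ (f≤g 0 z<s) (∑-mono-≤ n (λ l l<n → f≤g (suc l) (s<s l<n)))

∑-monoʳ-≤ : ∀ (f : ℕ → ℕ) {m n} → m ≤ n → ∑< m f ≤ ∑< n f
∑-monoʳ-≤ f z≤n       = z≤n
∑-monoʳ-≤ f (s≤s m≤n) = +-monoʳ-≤ (f 0) (∑-monoʳ-≤ (f ∘ suc) m≤n)

∑-distrib-+ : ∀ n (f g : ℕ → ℕ) → (∑[ l < n ] f l + g l) ≡ ∑< n f + ∑< n g
∑-distrib-+ zero    f g = refl
∑-distrib-+ (suc n) f g = trans (cong (f 0 + g 0 +_) (∑-distrib-+ n (f ∘ suc) (g ∘ suc)))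
                                (+-interchange (f 0) (g 0) _ _)
  where
  +-interchange : ∀ a b c d → (a + b) + (c + d) ≡ (a + c) + (b + d)
  +-interchange = solve-∀

*-distribˡ-∑ : ∀ n c (f : ℕ → ℕ) → c * ∑< n f ≡ (∑[ l < n ] c * f l)
*-distribˡ-∑ zero    c f = *-zeroʳ c
*-distribˡ-∑ (suc n) c f = trans (*-distribˡ-+ c (f 0) _) (cong (c * f 0 +_) (*-distribˡ-∑ n c (f ∘ suc)))

*-distribʳ-∑ : ∀ n c (f : ℕ → ℕ) → ∑< n f * c ≡ (∑[ l < n ] f l * c)
*-distribʳ-∑ n c f = trans (*-comm _ c) (trans (*-distribˡ-∑ n c f) (∑-cong n (λ l _ → *-comm c (f l))))

∑-last : ∀ n (f : ℕ → ℕ) → ∑< (suc n) f ≡ ∑< n f + f n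
∑-last zero    f = +-comm (f 0) 0
∑-last (suc n) f = trans (cong (f 0 +_) (∑-last n (f ∘ suc))) (sym (+-assoc (f 0) _ _))

∑-fromFin : ∀ n (f : ℕ → ℕ) → MonoidSum.sum (λ (k : Fin n) → f (toℕ k)) ≡ ∑< n f
∑-fromFin zero    f = refl
∑-fromFin (suc n) f = cong (f 0 +_) (∑-fromFin n (f ∘ suc))

binomial : ∀ x y M → (x + y) ^ M ≡ ∑[ l < suc M ] (M C l) * (x ^ l * y ^ (M ∸ l))
binomial x y M = begin
  (x + y) ^ M                                                    ≡⟨ ^-fromSemiring (x + y) M ⟨
  (x + y) RawSemiring.^ M                                        ≡⟨ Binomial.theorem M x y ⟩
  Binomial.binomialExpansion x y M                               ≡⟨ ∑-fromFin (suc M) term ⟩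
  ∑< (suc M) term                                                ≡⟨ ∑-cong (suc M) (λ l _ → term≡ l) ⟩
  ∑[ l < suc M ] (M C l) * (x ^ l * y ^ (M ∸ l))                 ∎
  where
  open ≡-Reasoning
  term : ℕ → ℕ
  term l = (M C l) RawSemiring.× (x RawSemiring.^ l * y RawSemiring.^ (M ∸ l))
  ^-fromSemiring : ∀ x n → x RawSemiring.^ n ≡ x ^ n
  ^-fromSemiring x zero    = refl
  ^-fromSemiring x (suc n) = cong (x *_) (^-fromSemiring x n)
  ×-fromSemiring : ∀ n x → n RawSemiring.× x ≡ n * x
  ×-fromSemiring zero    x = refl
  ×-fromSemiring (suc n) x = cong (x +_) (×-fromSemiring n x)
  term≡ : ∀ l → term l ≡ (M C l) * (x ^ l * y ^ (M ∸ l))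
  term≡ l = trans (×-fromSemiring (M C l) _)
                  (cong₂ (λ a b → (M C l) * (a * b)) (^-fromSemiring x l) (^-fromSemiring y (M ∸ l)))

C*factorials≡! : ∀ {n k} → k ≤ n → (n C k) * (k ! * (n ∸ k) !) ≡ n !
C*factorials≡! {n} {k} k≤n =
  trans (cong (_* (k ! * (n ∸ k) !)) (nCk≡n!/k![n-k]! k≤n))
        (m/n*n≡m {{k !* (n ∸ k) !≢0}} (k![n∸k]!∣n! k≤n))

C-absorption : ∀ {M l} → l ≤ M → (suc M C l) * suc (M ∸ l) ≡ suc M * (M C l)
C-absorption {M} {l} l≤M = *-cancelʳ-≡ _ _ (l ! * (M ∸ l) !) {{l !* (M ∸ l) !≢0}} (begin
  (suc M C l) * suc (M ∸ l) * (l ! * (M ∸ l) !)    ≡⟨ shuffle (suc M C l) (suc (M ∸ l)) (l !) ((M ∸ l) !) ⟩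
  (suc M C l) * (l ! * suc (M ∸ l) !)              ≡⟨ cong (λ m → (suc M C l) * (l ! * m !)) (+-∸-assoc 1 l≤M) ⟨
  (suc M C l) * (l ! * (suc M ∸ l) !)              ≡⟨ C*factorials≡! (m≤n⇒m≤1+n l≤M) ⟩
  suc M !                                          ≡⟨ cong (suc M *_) (C*factorials≡! l≤M) ⟨
  suc M * ((M C l) * (l ! * (M ∸ l) !))            ≡⟨ *-assoc (suc M) (M C l) _ ⟨
  suc M * (M C l) * (l ! * (M ∸ l) !)              ∎)
  where
  open ≡-Reasoning
  shuffle : ∀ c s a b → c * s * (a * b) ≡ c * (a * (s * b))
  shuffle = solve-∀

expSum-zero : ∀ M → expSum 0 M ≡ M !
expSum-zero zero    = refl
expSum-zero (suc M) = trans (+-identityʳ _) (cong (suc M *_) (expSum-zero M))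

expSum-+-step : ∀ x y {M l} → l ≤ M →
                suc M * ((M C l) * (y ^ l * expSum x (M ∸ l))) + (suc M C l) * (y ^ l * x ^ (suc M ∸ l))
                ≡ (suc M C l) * (y ^ l * expSum x (suc M ∸ l))
expSum-+-step x y {M} {l} l≤M = sym (begin
  (suc M C l) * (y ^ l * expSum x (suc M ∸ l))
    ≡⟨ cong (λ m → (suc M C l) * (y ^ l * expSum x m)) 1+M∸l ⟩
  (suc M C l) * (y ^ l * (suc (M ∸ l) * expSum x (M ∸ l) + x ^ suc (M ∸ l)))
    ≡⟨ distribute (suc M C l) (y ^ l) (suc (M ∸ l)) (expSum x (M ∸ l)) (x ^ suc (M ∸ l)) ⟩
  (suc M C l) * suc (M ∸ l) * (y ^ l * expSum x (M ∸ l)) + (suc M C l) * (y ^ l * x ^ suc (M ∸ l))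
    ≡⟨ cong₂ _+_ (trans (cong (_* (y ^ l * expSum x (M ∸ l))) (C-absorption l≤M)) (*-assoc (suc M) (M C l) _))
                 (cong (λ m → (suc M C l) * (y ^ l * x ^ m)) (sym 1+M∸l)) ⟩
  suc M * ((M C l) * (y ^ l * expSum x (M ∸ l))) + (suc M C l) * (y ^ l * x ^ (suc M ∸ l))
    ∎)
  where
  open ≡-Reasoning
  1+M∸l : suc M ∸ l ≡ suc (M ∸ l)
  1+M∸l = +-∸-assoc 1 l≤M
  distribute : ∀ c yl s e xp → c * (yl * (s * e + xp)) ≡ c * s * (yl * e) + c * (yl * xp)
  distribute = solve-∀

-- Divided by M!, this is T_M(x + y) = Σ_{l≤M} (y^l / l!) T_{M-l}(x).
expSum-+ : ∀ x y M → expSum (x + y) M ≡ ∑[ l < suc M ] (M C l) * (y ^ l * expSum x (M ∸ l))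
expSum-+ x y zero    = refl
expSum-+ x y (suc M) = begin
  suc M * expSum (x + y) M + (x + y) ^ suc M
    ≡⟨ cong₂ _+_ (cong (suc M *_) (expSum-+ x y M)) (trans (cong (_^ suc M) (+-comm x y)) (binomial y x (suc M))) ⟩
  suc M * ∑< (suc M) (t M) + ∑< (suc (suc M)) (b (suc M))
    ≡⟨ cong₂ _+_ (*-distribˡ-∑ (suc M) (suc M) (t M)) (∑-last (suc M) (b (suc M))) ⟩
  (∑[ l < suc M ] suc M * t M l) + (∑< (suc M) (b (suc M)) + b (suc M) (suc M))
    ≡⟨ +-assoc (∑[ l < suc M ] suc M * t M l) _ _ ⟨
  (∑[ l < suc M ] suc M * t M l) + ∑< (suc M) (b (suc M)) + b (suc M) (suc M)
    ≡⟨ cong₂ _+_ (∑-distrib-+ (suc M) (λ l → suc M * t M l) (b (suc M))) (sym top) ⟨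
  (∑[ l < suc M ] suc M * t M l + b (suc M) l) + t (suc M) (suc M)
    ≡⟨ cong (_+ t (suc M) (suc M)) (∑-cong (suc M) (λ l l<1+M → expSum-+-step x y (s≤s⁻¹ l<1+M))) ⟩
  ∑< (suc M) (t (suc M)) + t (suc M) (suc M)
    ≡⟨ ∑-last (suc M) (t (suc M)) ⟨
  ∑< (suc (suc M)) (t (suc M))
    ∎
  where
  open ≡-Reasoning
  t b : ℕ → ℕ → ℕ
  t M l = (M C l) * (y ^ l * expSum x (M ∸ l))
  b M l = (M C l) * (y ^ l * x ^ (M ∸ l))
  top : b (suc M) (suc M) ≡ t (suc M) (suc M)
  top = cong (λ m → (suc M C suc M) * (y ^ suc M * m))
             (trans (cong (x ^_) (n∸n≡0 M)) (cong (expSum x) (sym (n∸n≡0 M))))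

expSum-expand : ∀ b K → expSum b K ≡ ∑[ l < suc K ] (K C l) * (b ^ l * (K ∸ l) !)
expSum-expand b K = trans (expSum-+ 0 b K)
  (∑-cong (suc K) (λ l _ → cong (λ m → (K C l) * (b ^ l * m)) (expSum-zero (K ∸ l))))

expSum-mono : ∀ a {j k} → j ≤ k → expSum a j * k ! ≤ expSum a k * j !
expSum-mono a {j} {k} j≤k = subst (λ k → expSum a j * k ! ≤ expSum a k * j !) (m+[n∸m]≡n j≤k) (go (k ∸ j))
  where
  open ≤-Reasoning
  swap : ∀ e s f → e * (s * f) ≡ s * (e * f)
  swap = solve-∀
  go : ∀ t → expSum a j * (j + t) ! ≤ expSum a (j + t) * j !
  go zero rewrite +-identityʳ j = ≤-refl
  go (suc t) rewrite +-suc j t = begin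
    expSum a j * (suc (j + t) * (j + t) !)           ≡⟨ swap (expSum a j) (suc (j + t)) ((j + t) !) ⟩
    suc (j + t) * (expSum a j * (j + t) !)           ≤⟨ *-monoʳ-≤ (suc (j + t)) (go t) ⟩
    suc (j + t) * (expSum a (j + t) * j !)           ≡⟨ *-assoc (suc (j + t)) (expSum a (j + t)) (j !) ⟨
    suc (j + t) * expSum a (j + t) * j !             ≤⟨ *-monoˡ-≤ (j !) (m≤m+n (suc (j + t) * expSum a (j + t)) (a ^ suc (j + t))) ⟩
    expSum a (suc (j + t)) * j !                     ∎

expSum-+-≤-* : ∀ a b K → expSum (a + b) K * K ! ≤ expSum a K * expSum b K
expSum-+-≤-* a b K = begin
  expSum (a + b) K * K !                                    ≡⟨ cong (_* K !) (expSum-+ a b K) ⟩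
  ∑< (suc K) t * K !                                        ≡⟨ *-distribʳ-∑ (suc K) (K !) t ⟩
  (∑[ l < suc K ] t l * K !)                                ≤⟨ ∑-mono-≤ (suc K) (λ l _ → term l) ⟩
  (∑[ l < suc K ] expSum a K * f l)                         ≡⟨ *-distribˡ-∑ (suc K) (expSum a K) f ⟨
  expSum a K * ∑< (suc K) f                                 ≡⟨ cong (expSum a K *_) (expSum-expand b K) ⟨
  expSum a K * expSum b K                                   ∎
  where
  open ≤-Reasoning
  t f : ℕ → ℕ
  t l = (K C l) * (b ^ l * expSum a (K ∸ l))
  f l = (K C l) * (b ^ l * (K ∸ l) !)
  regroup₁ : ∀ c bl e k → c * (bl * e) * k ≡ c * bl * (e * k)
  regroup₁ = solve-∀
  regroup₂ : ∀ ea c bl g → ea * (c * (bl * g)) ≡ c * bl * (ea * g)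
  regroup₂ = solve-∀
  term : ∀ l → t l * K ! ≤ expSum a K * f l
  term l = begin
    (K C l) * (b ^ l * expSum a (K ∸ l)) * K !        ≡⟨ regroup₁ (K C l) (b ^ l) (expSum a (K ∸ l)) (K !) ⟩
    (K C l) * b ^ l * (expSum a (K ∸ l) * K !)        ≤⟨ *-monoʳ-≤ ((K C l) * b ^ l) (expSum-mono a (m∸n≤m K l)) ⟩
    (K C l) * b ^ l * (expSum a K * (K ∸ l) !)        ≡⟨ regroup₂ (expSum a K) (K C l) (b ^ l) ((K ∸ l) !) ⟨
    expSum a K * f l                                  ∎

expSum-*-≤-+ : ∀ a b K L → expSum a K * expSum b L * (K + L) ! ≤ expSum (a + b) (K + L) * (K ! * L !)
expSum-*-≤-+ a b K L = begin
  expSum a K * expSum b L * (K + L) !               ≡⟨ cong (λ m → expSum a K * m * (K + L) !) (expSum-expand b L) ⟩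
  expSum a K * ∑< (suc L) f * (K + L) !             ≡⟨ cong (_* (K + L) !) (*-distribˡ-∑ (suc L) (expSum a K) f) ⟩
  (∑[ l < suc L ] expSum a K * f l) * (K + L) !     ≡⟨ *-distribʳ-∑ (suc L) ((K + L) !) (λ l → expSum a K * f l) ⟩
  (∑[ l < suc L ] expSum a K * f l * (K + L) !)     ≤⟨ ∑-mono-≤ (suc L) (λ l l<1+L → term (s≤s⁻¹ l<1+L)) ⟩
  (∑[ l < suc L ] t l * (K ! * L !))                ≤⟨ ∑-monoʳ-≤ (λ l → t l * (K ! * L !)) (s≤s (m≤n+m L K)) ⟩
  (∑[ l < suc (K + L) ] t l * (K ! * L !))          ≡⟨ *-distribʳ-∑ (suc (K + L)) (K ! * L !) t ⟨
  ∑< (suc (K + L)) t * (K ! * L !)                  ≡⟨ cong (_* (K ! * L !)) (expSum-+ a b (K + L)) ⟨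
  expSum (a + b) (K + L) * (K ! * L !)              ∎
  where
  open ≤-Reasoning
  f t : ℕ → ℕ
  f l = (L C l) * (b ^ l * (L ∸ l) !)
  t l = ((K + L) C l) * (b ^ l * expSum a (K + L ∸ l))
  regroup₁ : ∀ ea c bl g kl lf h → ea * (c * (bl * g)) * kl * (lf * h) ≡ bl * ea * kl * h * (c * (lf * g))
  regroup₁ = solve-∀
  regroup₂ : ∀ bl ea kl h lfac → bl * ea * kl * h * lfac ≡ bl * lfac * kl * (ea * h)
  regroup₂ = solve-∀
  regroup₃ : ∀ bl lfac kl eb kf → bl * lfac * kl * (eb * kf) ≡ bl * eb * kf * lfac * kl
  regroup₃ = solve-∀
  regroup₄ : ∀ c bl eb kf lfac lf h → c * (bl * eb) * (kf * lfac) * (lf * h) ≡ bl * eb * kf * lfac * (c * (lf * h))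
  regroup₄ = solve-∀
  term : ∀ {l} → l ≤ L → expSum a K * f l * (K + L) ! ≤ t l * (K ! * L !)
  term {l} l≤L = *-cancelʳ-≤ _ _ (l ! * (K + L ∸ l) !) {{l !* (K + L ∸ l) !≢0}} (begin
    expSum a K * f l * (K + L) ! * (l ! * (K + L ∸ l) !)
      ≡⟨ regroup₁ (expSum a K) (L C l) (b ^ l) ((L ∸ l) !) ((K + L) !) (l !) ((K + L ∸ l) !) ⟩
    b ^ l * expSum a K * (K + L) ! * (K + L ∸ l) ! * ((L C l) * (l ! * (L ∸ l) !))
      ≡⟨ cong (b ^ l * expSum a K * (K + L) ! * (K + L ∸ l) ! *_) (C*factorials≡! l≤L) ⟩
    b ^ l * expSum a K * (K + L) ! * (K + L ∸ l) ! * L !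
      ≡⟨ regroup₂ (b ^ l) (expSum a K) ((K + L) !) ((K + L ∸ l) !) (L !) ⟩
    b ^ l * L ! * (K + L) ! * (expSum a K * (K + L ∸ l) !)
      ≤⟨ *-monoʳ-≤ (b ^ l * L ! * (K + L) !) (expSum-mono a K≤K+L∸l) ⟩
    b ^ l * L ! * (K + L) ! * (expSum a (K + L ∸ l) * K !)
      ≡⟨ regroup₃ (b ^ l) (L !) ((K + L) !) (expSum a (K + L ∸ l)) (K !) ⟩
    b ^ l * expSum a (K + L ∸ l) * K ! * L ! * (K + L) !
      ≡⟨ cong (b ^ l * expSum a (K + L ∸ l) * K ! * L ! *_) (C*factorials≡! (≤-trans l≤L (m≤n+m L K))) ⟨
    b ^ l * expSum a (K + L ∸ l) * K ! * L ! * (((K + L) C l) * (l ! * (K + L ∸ l) !))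
      ≡⟨ regroup₄ ((K + L) C l) (b ^ l) (expSum a (K + L ∸ l)) (K !) (L !) (l !) ((K + L ∸ l) !) ⟨
    t l * (K ! * L !) * (l ! * (K + L ∸ l) !)
      ∎)
    where
    K≤K+L∸l : K ≤ K + L ∸ l
    K≤K+L∸l = subst (K ≤_) (sym (+-∸-assoc K l≤L)) (m≤m+n K (L ∸ l))

LeExp-* : ∀ {x y a b} → LeExp x a → LeExp y b → LeExp (x * y) (a + b)
LeExp-* {x} {y} {a} {b} (K , x≤eᵃ) (L , y≤eᵇ) = K + L , *-cancelʳ-≤ _ _ (K ! * L !) {{K !* L !≢0}} (begin
  x * y * (K + L) ! * (K ! * L !)          ≡⟨ regroup x y ((K + L) !) (K !) (L !) ⟩
  x * K ! * (y * L !) * (K + L) !          ≤⟨ *-monoˡ-≤ ((K + L) !) (*-mono-≤ x≤eᵃ y≤eᵇ) ⟩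
  expSum a K * expSum b L * (K + L) !      ≤⟨ expSum-*-≤-+ a b K L ⟩
  expSum (a + b) (K + L) * (K ! * L !)     ∎)
  where
  open ≤-Reasoning
  regroup : ∀ x y kl k l → x * y * kl * (k * l) ≡ x * k * (y * l) * kl
  regroup = solve-∀

LeExp-^ : ∀ {x a} t → LeExp x a → LeExp (x ^ t) (t * a)
LeExp-^ zero    _      = 0 , ≤-refl
LeExp-^ {x} {a} (suc t) x≤eᵃ = LeExp-* {x} {x ^ t} {a} x≤eᵃ (LeExp-^ {x} {a} t x≤eᵃ)

LeExp-≤ : ∀ {x y a} → x ≤ y → LeExp y a → LeExp x a
LeExp-≤ x≤y (K , y≤eᵃ) = K , ≤-trans (*-monoˡ-≤ _ x≤y) y≤eᵃ

LeExp-√ : ∀ {x a} → LeExp (x * x) (a + a) → LeExp x a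
LeExp-√ {x} {a} (K , x²≤e²ᵃ) = K , m*m≤n*n⇒m≤n (begin
  x * K ! * (x * K !)         ≡⟨ regroup x (K !) ⟩
  x * x * K ! * K !           ≤⟨ *-monoˡ-≤ (K !) x²≤e²ᵃ ⟩
  expSum (a + a) K * K !      ≤⟨ expSum-+-≤-* a a K ⟩
  expSum a K * expSum a K     ∎)
  where
  open ≤-Reasoning
  regroup : ∀ x k → x * k * (x * k) ≡ x * x * k * k
  regroup = solve-∀

9≤e³ : LeExp 9 3
9≤e³ = 6 , toWitness {a? = 9 * 6 ! ≤? expSum 3 6} tt

LeExp-count : ∀ {N n c} d → LeExp (N * N) n → c ≤ N ^ d * (3 ^ d) ^ n → LeExp c (2 * n * d)
LeExp-count {N} {n} {c} d N²≤eⁿ c≤B = LeExp-√ {c} {2 * n * d} c²≤e⁴ⁿᵈ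
  where
  open ≡-Reasoning
  regroup : ∀ x y → x * y * (x * y) ≡ x * x * (y * y)
  regroup = solve-∀
  exponent : ∀ d n → d * n + d * n * 3 ≡ 2 * n * d + 2 * n * d
  exponent = solve-∀
  B²≡ : N ^ d * (3 ^ d) ^ n * (N ^ d * (3 ^ d) ^ n) ≡ (N * N) ^ d * 9 ^ (d * n)
  B²≡ = begin
    N ^ d * (3 ^ d) ^ n * (N ^ d * (3 ^ d) ^ n)    ≡⟨ cong (λ m → N ^ d * m * (N ^ d * m)) (^-*-assoc 3 d n) ⟩
    N ^ d * 3 ^ (d * n) * (N ^ d * 3 ^ (d * n))    ≡⟨ regroup (N ^ d) (3 ^ (d * n)) ⟩
    N ^ d * N ^ d * (3 ^ (d * n) * 3 ^ (d * n))    ≡⟨ cong₂ _*_ (^-distribʳ-* N N d) (^-distribʳ-* 3 3 (d * n)) ⟨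
    (N * N) ^ d * 9 ^ (d * n)                      ∎
  B²≤e⁴ⁿᵈ : LeExp ((N * N) ^ d * 9 ^ (d * n)) (d * n + d * n * 3)
  B²≤e⁴ⁿᵈ = LeExp-* {(N * N) ^ d} {9 ^ (d * n)} (LeExp-^ {N * N} {n} d N²≤eⁿ) (LeExp-^ {9} {3} (d * n) 9≤e³)
  c²≤e⁴ⁿᵈ : LeExp (c * c) (2 * n * d + 2 * n * d)
  c²≤e⁴ⁿᵈ = subst (LeExp (c * c)) (exponent d n)
              (LeExp-≤ {c * c} (≤-trans (*-mono-≤ c≤B c≤B) (≤-reflexive B²≡)) B²≤e⁴ⁿᵈ)

lemma6 : (N : ℕ) (_∙_ : Op₂ (Fin N)) (e : Fin N) (inv : Op₁ (Fin N)) →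
         IsAbelianGroup _≡_ _∙_ e inv →
         (n d : ℕ) → LeExp (N * N) n →
         (Xs : List (Subset N)) → Unique Xs →
         All (λ X → 0 < ∣ X ∣ × ∣ X ∣ ≤ n × DimLe _∙_ e inv X d) Xs →
         LeExp (length Xs) (2 * n * d)
lemma6 N _∙_ e inv isAbelianGroup n d N²≤eⁿ Xs unique Xs-props =
  LeExp-count d N²≤eⁿ (bounded-dimension-count isAbelianGroup n d unique Xs-props)
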